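{- Let $n\ge 0$ and let $G\in\mathfrak{G}_n$ have exactly $s$ 2-cycles. Then the number of involutions $\pi$ of $[n]$ with $\Gamma(\pi)=G$ equals $2^{\lfloor n/2\rfloor-s}$.
   Context: Write $n=2t+r$ with $r\in\{0,1\}$. Let $V_n=\{v_1,\dots,v_t\}$ if $r=0$ and $V_n=\{v_1,\dots,v_{t+1}\}$ if $r=1$. The block of $v_j$ ($j\le t$) is $\{2j-1,2j\}$, and the block of $v_{t+1}$ (when $n$ is odd) is $\{n\}$. $\mathfrak{G}_n$ is the set of loopless multigraphs on $V_n$ in which every vertex has degree at most $2$, $v_{t+1}$ (if present) has degree at most $1$, and every edge has multiplicity at most $2$. A 2-cycle of such a graph is a pair of vertices joined by an edge of multiplicity $2$. For an involution $\pi$ of $[n]$ (i.e. $\pi^2=1$), $\Gamma(\pi)\in\mathfrak{G}_n$ is the multigraph on $V_n$ having one edge between the vertices of the blocks of $a$ and $b$ for each transposition $(a,b)$ of $\pi$ with $a,b$ in different blocks (transpositions inside a block and fixed points contribute no edge). -}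

module Defs where

open import Data.Nat using (ℕ; zero; suc; _≤_; _<_; ⌊_/2⌋; ⌈_/2⌉; _≟_; _<?_)
open import Data.Nat.Properties using (⌈n/2⌉-mono)
open import Data.Nat.ListAction using (sum)
open import Data.Fin using (Fin; toℕ; fromℕ<)
import Data.Fin.Properties as FinP
open import Data.Fin.Properties using (all?)
open import Data.List using (List; []; _∷_; [_]; map; concatMap; length; filter; allFin; cartesianProduct)
open import Data.Vec using (Vec; lookup) renaming ([] to []ᵥ; _∷_ to _∷ᵥ_)
open import Data.Product using (_×_; _,_; proj₁; proj₂)
open import Relation.Nullary using (Dec; yes; no)
open import Relation.Nullary.Decidable using (_×-dec_)
open import Relation.Binary.PropositionalEquality using (_≡_)

-- Vertex set V_n is represented by Fin ⌈ n /2⌉ ; vertex index j (0-based)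
-- corresponds to v_{j+1}.  Elements of [n] are Fin n (0-based): element a
-- lies in the block of vertex ⌊ a /2⌋.  (0-based {2j,2j+1} = 1-based {2j+1,2j+2}.)
Vtx : ℕ → Set
Vtx n = Fin ⌈ n /2⌉

block : {n : ℕ} → Fin n → Vtx n
block {n} a = fromℕ< (⌈n/2⌉-mono (FinP.toℕ<n a))

MGraph : ℕ → Set
MGraph n = Vtx n → Vtx n → ℕ

degree : {n : ℕ} → MGraph n → Vtx n → ℕ
degree {n} G u = sum (map (G u) (allFin ⌈ n /2⌉))

record InG (n : ℕ) (G : MGraph n) : Set where
  field
    symmetric  : ∀ u w → G u w ≡ G w u
    loopless   : ∀ u → G u u ≡ 0
    multAtMost2 : ∀ u w → G u w ≤ 2
    degAtMost2 : ∀ u → degree G u ≤ 2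
    -- v_{t+1} (0-based index ⌊n/2⌋, present only when n is odd) has degree ≤ 1
    lastDeg    : ∀ u → toℕ u ≡ ⌊ n /2⌋ → degree G u ≤ 1

twoCycles : {n : ℕ} → MGraph n → ℕ
twoCycles {n} G =
  length (filter (λ p → (toℕ (proj₁ p) <? toℕ (proj₂ p)) ×-dec (G (proj₁ p) (proj₂ p) ≟ 2))
                 (cartesianProduct (allFin ⌈ n /2⌉) (allFin ⌈ n /2⌉)))

IsInvolution : {n : ℕ} → Vec (Fin n) n → Set
IsInvolution {n} π = ∀ i → lookup π (lookup π i) ≡ i

isInvolution? : {n : ℕ} → (π : Vec (Fin n) n) → Dec (IsInvolution π)
isInvolution? π = all? (λ i → lookup π (lookup π i) FinP.≟ i)

-- Γ(π): for u ≠ w, the number of a in the block of u with π(a) in the block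
-- of w; for an involution this is the number of transpositions (a,b) of π
-- joining the blocks of u and w.  No loops.
Γ : {n : ℕ} → Vec (Fin n) n → MGraph n
Γ {n} π u w with toℕ u ≟ toℕ w
... | yes _ = 0
... | no _  = length (filter (λ a → (block a FinP.≟ u) ×-dec (block (lookup π a) FinP.≟ w))
                             (allFin n))

GraphEq : {n : ℕ} → MGraph n → MGraph n → Set
GraphEq G H = ∀ u w → G u w ≡ H u w

graphEq? : {n : ℕ} → (G H : MGraph n) → Dec (GraphEq G H)
graphEq? G H = all? (λ u → all? (λ w → G u w ≟ H u w))

allVecs : {A : Set} → List A → (k : ℕ) → List (Vec A k)
allVecs xs zero    = [ []ᵥ ]
allVecs xs (suc k) = concatMap (λ x → map (x ∷ᵥ_) (allVecs xs k)) xs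

allMaps : (n : ℕ) → List (Vec (Fin n) n)
allMaps n = allVecs (allFin n) n

countInvolutions : (n : ℕ) → MGraph n → ℕ
countInvolutions n G =
  length (filter (λ π → isInvolution? π ×-dec graphEq? (Γ π) G) (allMaps n))

module Submission where

-- Write an element of [n] as a pair (u , p): the vertex u whose block contains it and its
-- parity p.  Every vertex u of G ∈ 𝔊ₙ has two slots holding its neighbours with multiplicity,
-- and a slot of u holding w is matched with a slot of w holding u.  An involution π with
-- Γ(π) = G is determined by one bit per vertex saying which element of its block occupies
-- which slot: π sends the element in a slot to the element in the matched slot, fixes an
-- element in an empty slot, and is the identity or the swap on an isolated full block.
-- The bit is forced on the one-element block of an odd n, and on a 2-cycle only the xor of
-- the two bits matters; fixing the bit of the larger end to 0 leaves ⌊n/2⌋ − s free bits,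
-- and every choice of them gives exactly one such involution.

open import Defs
open import Data.Bool using (Bool; true; false; not; _xor_; if_then_else_)
open import Data.Bool.Properties using (not-involutive; ¬-not; xor-assoc; xor-same; xor-identityʳ; not-distribˡ-xor)
open import Data.Empty using (⊥-elim)
open import Data.Fin using (Fin; zero; suc; toℕ; fromℕ<; inject≤) renaming (_≟_ to _≟ᶠ_)
open import Data.Fin.Properties using (toℕ-fromℕ<; toℕ-injective; toℕ-inject≤; toℕ<n; any?; <-cmp)
open import Data.List
  using (List; []; _∷_; [_]; _++_; length; map; filter; allFin; replicate; concatMap; head; drop; cartesianProduct)
open import Data.List.Membership.Propositional using (_∈_; _∉_)
open import Data.List.Membership.Propositional.Properties
  using (∈-map⁺; ∈-map⁻; ∈-++⁺ˡ; ∈-++⁺ʳ; ∈-++⁻; ∈-concatMap⁺; ∈-allFin; ∈-filter⁺; ∈-filter⁻;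
         ∈-cartesianProduct⁺)
open import Data.List.Membership.Propositional.Properties.WithK using (unique∧set⇒bag)
import Data.List as List
open import Data.List.Properties using (length-map; length-++; length-replicate; length-tabulate; filter-++)
open import Data.List.Relation.Binary.BagAndSetEquality using (∼bag⇒↭)
open import Data.List.Relation.Binary.Permutation.Propositional.Properties using (↭-length)
open import Data.List.Relation.Unary.All as All using (All; []; _∷_)
import Data.List.Relation.Unary.All.Properties as All
open import Data.List.Relation.Unary.AllPairs as AllPairs using ([]; _∷_)
import Data.List.Relation.Unary.AllPairs.Properties as AllPairs
open import Data.List.Relation.Unary.Any as Any using (here; there)
open import Data.List.Relation.Unary.Unique.Propositional using (Unique)
import Data.List.Relation.Unary.Unique.Propositional.Properties as Unique
open import Data.Maybe using (Maybe; just; nothing)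
open import Data.Maybe.Properties using (just-injective) renaming (≡-dec to ≡-dec-Maybe)
open import Data.Nat
  using (ℕ; zero; suc; _+_; _∸_; _^_; _≤_; _<_; _<?_; s≤s; z≤n; ⌊_/2⌋; ⌈_/2⌉) renaming (_≟_ to _≟ⁿ_)
open import Data.Nat.ListAction using (sum)
open import Data.Nat.Properties
  using (+-comm; +-suc; +-identityʳ; +-cancelˡ-≡; 1+n≢0; <-asym; m+n∸m≡n; ⌊n/2⌋≤⌈n/2⌉)
open import Data.Product using (_×_; _,_; proj₁; proj₂; ∃; ∃₂; uncurry)
open import Data.Sum using (_⊎_; inj₁; inj₂)
open import Data.Vec using (Vec; lookup; tabulate) renaming ([] to []ᵥ; _∷_ to _∷ᵥ_)
open import Data.Vec.Properties using (∷-injectiveˡ; ∷-injectiveʳ; lookup∘tabulate; tabulate∘lookup; tabulate-cong)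
open import Function using (_∘_; id; case_of_)
open import Function.Bundles using (mk⇔)
open import Relation.Binary.Definitions using (DecidableEquality; tri<; tri≈; tri>)
open import Relation.Binary.PropositionalEquality hiding ([_])
open import Relation.Nullary using (Dec; yes; no; ¬_; does; ¬?)
open import Relation.Nullary.Decidable using (_×-dec_)
open import Relation.Unary using (Decidable)

indicator : {P : Set} → Dec P → ℕ
indicator (yes _) = 1
indicator (no _) = 0

module _ {P : Set} where

  indicator-yes : (P? : Dec P) → P → indicator P? ≡ 1
  indicator-yes (yes _) _ = refl
  indicator-yes (no ¬p) p = ⊥-elim (¬p p)

  indicator-no : (P? : Dec P) → ¬ P → indicator P? ≡ 0
  indicator-no (yes p) ¬p = ⊥-elim (¬p p)
  indicator-no (no _) _ = refl

module _ {P Q : Set} where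

  indicator-sum-≢0 : (P? : Dec P) (Q? : Dec Q) → indicator P? + indicator Q? ≢ 0 → P ⊎ Q
  indicator-sum-≢0 (yes p) _ _ = inj₁ p
  indicator-sum-≢0 (no _) (yes q) _ = inj₂ q
  indicator-sum-≢0 (no _) (no _) ≢0 = ⊥-elim (≢0 refl)

  indicator-sum-≡2 : (P? : Dec P) (Q? : Dec Q) → indicator P? + indicator Q? ≡ 2 → P × Q
  indicator-sum-≡2 (yes p) (yes q) _ = p , q
  indicator-sum-≡2 (yes _) (no _) ()
  indicator-sum-≡2 (no _) (yes _) ()
  indicator-sum-≡2 (no _) (no _) ()

length-≡-of-same-elements : {A : Set} {xs ys : List A} → Unique xs → Unique ys →
  (∀ {x} → x ∈ xs → x ∈ ys) → (∀ {x} → x ∈ ys → x ∈ xs) → length xs ≡ length ys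
length-≡-of-same-elements xs! ys! to from = ↭-length (∼bag⇒↭ (unique∧set⇒bag xs! ys! (mk⇔ to from)))

Unique-map⁺ : {A B : Set} {f : A → B} {xs : List A} →
  (∀ {x y} → x ∈ xs → y ∈ xs → f x ≡ f y → x ≡ y) → Unique xs → Unique (map f xs)
Unique-map⁺ {xs = []} f-inj [] = []
Unique-map⁺ {xs = x ∷ xs} f-inj (x∉xs ∷ xs!) =
  All.map⁺ (All.tabulate λ y∈xs fx≡fy → All.lookup x∉xs y∈xs (f-inj (here refl) (there y∈xs) fx≡fy))
  ∷ Unique-map⁺ (λ x∈ y∈ → f-inj (there x∈) (there y∈)) xs!

length-≡-via-bijection : {A B : Set} {xs : List A} {ys : List B} (f : A → B) →
  Unique xs → Unique ys →
  (∀ {x y} → x ∈ xs → y ∈ xs → f x ≡ f y → x ≡ y) →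
  (∀ {x} → x ∈ xs → f x ∈ ys) →
  (∀ {y} → y ∈ ys → ∃ λ x → x ∈ xs × f x ≡ y) →
  length xs ≡ length ys
length-≡-via-bijection {xs = xs} f xs! ys! f-inj into onto =
  trans (sym (length-map f xs)) (length-≡-of-same-elements (Unique-map⁺ f-inj xs!) ys! to from)
  where
  to : ∀ {y} → y ∈ map f xs → y ∈ _
  to y∈ with ∈-map⁻ f y∈
  ... | x , x∈ , refl = into x∈
  from : ∀ {y} → y ∈ _ → y ∈ map f xs
  from y∈ with onto y∈
  ... | x , x∈ , refl = ∈-map⁺ f x∈

length-filter+length-filter-∁ : {A : Set} {P : A → Set} (P? : Decidable P) (xs : List A) →
  length (filter P? xs) + length (filter (λ x → ¬? (P? x)) xs) ≡ length xs
length-filter+length-filter-∁ P? [] = refl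
length-filter+length-filter-∁ P? (x ∷ xs) with P? x
... | yes _ = cong suc (length-filter+length-filter-∁ P? xs)
... | no _ = trans (+-suc _ _) (cong suc (length-filter+length-filter-∁ P? xs))

length-filter-tabulate : {A : Set} {P : A → Set} (P? : Decidable P) {k : ℕ} (f : Fin k → A) →
  length (filter P? (List.tabulate f)) ≡ length (filter (P? ∘ f) (allFin k))
length-filter-tabulate P? {zero} f = refl
length-filter-tabulate P? {suc k} f with does (P? (f zero))
... | true = cong suc (trans (length-filter-tabulate P? (f ∘ suc)) (sym (length-filter-tabulate (P? ∘ f) suc)))
... | false = trans (length-filter-tabulate P? (f ∘ suc)) (sym (length-filter-tabulate (P? ∘ f) suc))

length-concatMap-replicate : {A : Set} (f : A → ℕ) (ys : List A) →
  length (concatMap (λ y → replicate (f y) y) ys) ≡ sum (map f ys)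
length-concatMap-replicate f [] = refl
length-concatMap-replicate f (y ∷ ys) = trans (length-++ (replicate (f y) y))
  (cong₂ _+_ (length-replicate (f y)) (length-concatMap-replicate f ys))

length-filter-[_] : {A : Set} {P : A → Set} (x : A) (P? : Decidable P) → length (filter P? [ x ]) ≡ indicator (P? x)
length-filter-[ x ] P? with P? x
... | yes _ = refl
... | no _ = refl

xor-cancelʳ : ∀ x y → (x xor y) xor y ≡ x
xor-cancelʳ x y = trans (xor-assoc x y y) (trans (cong (x xor_) (xor-same y)) (xor-identityʳ x))

xor-cancelˡ : ∀ x y → x xor (x xor y) ≡ y
xor-cancelˡ x y = trans (sym (xor-assoc x x y)) (cong (_xor y) (xor-same x))

∈-allVecs : {A : Set} {xs : List A} {k : ℕ} (v : Vec A k) → (∀ i → lookup v i ∈ xs) → v ∈ allVecs xs k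
∈-allVecs []ᵥ _ = here refl
∈-allVecs (x ∷ᵥ v) v⊆xs =
  ∈-concatMap⁺ _ (Any.map (λ { refl → ∈-map⁺ _ (∈-allVecs v (v⊆xs ∘ suc)) }) (v⊆xs zero))

allVecs-unique : {A : Set} {xs : List A} (k : ℕ) → Unique xs → Unique (allVecs xs k)
allVecs-unique zero _ = [] ∷ []
allVecs-unique {xs = xs} (suc k) xs! =
  Unique.concat⁺ (All.map⁺ (All.universal (λ _ → Unique.map⁺ ∷-injectiveʳ (allVecs-unique k xs!)) xs))
                 (AllPairs.map⁺ (AllPairs.map disjoint xs!))
  where
  disjoint : ∀ {x y} → x ≢ y → ∀ {v} →
    ¬ (v ∈ map (x ∷ᵥ_) (allVecs xs k) × v ∈ map (y ∷ᵥ_) (allVecs xs k))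
  disjoint x≢y (v∈ , v∈′) with ∈-map⁻ _ v∈ | ∈-map⁻ _ v∈′
  ... | _ , _ , refl | _ , _ , eq = x≢y (∷-injectiveˡ eq)

SupportedOn : {k : ℕ} → (Fin k → Set) → Vec Bool k → Set
SupportedOn P b = ∀ i → ¬ P i → lookup b i ≡ false

module _ {k : ℕ} {Q : Set} where

  extend : Dec Q → List (Vec Bool k) → List (Vec Bool (suc k))
  extend (yes _) vs = map (false ∷ᵥ_) vs ++ map (true ∷ᵥ_) vs
  extend (no _) vs = map (false ∷ᵥ_) vs

  ∈-extend⁺ : (Q? : Dec Q) {x : Bool} {v : Vec Bool k} {vs : List (Vec Bool k)} →
    (¬ Q → x ≡ false) → v ∈ vs → (x ∷ᵥ v) ∈ extend Q? vs
  ∈-extend⁺ (yes _) {false} _ v∈ = ∈-++⁺ˡ (∈-map⁺ _ v∈)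
  ∈-extend⁺ (yes _) {true} _ v∈ = ∈-++⁺ʳ _ (∈-map⁺ _ v∈)
  ∈-extend⁺ (no ¬q) x≡false v∈ rewrite x≡false ¬q = ∈-map⁺ _ v∈

  ∈-extend⁻ : (Q? : Dec Q) {x : Bool} {v : Vec Bool k} {vs : List (Vec Bool k)} →
    (x ∷ᵥ v) ∈ extend Q? vs → v ∈ vs × (¬ Q → x ≡ false)
  ∈-extend⁻ (yes q) {vs = vs} xv∈ with ∈-++⁻ (map (false ∷ᵥ_) vs) xv∈
  ... | inj₁ xv∈ˡ with ∈-map⁻ _ xv∈ˡ
  ...   | _ , v∈ , refl = v∈ , λ ¬q → ⊥-elim (¬q q)
  ∈-extend⁻ (yes q) {vs = vs} xv∈ | inj₂ xv∈ʳ with ∈-map⁻ _ xv∈ʳ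
  ...   | _ , v∈ , refl = v∈ , λ ¬q → ⊥-elim (¬q q)
  ∈-extend⁻ (no _) xv∈ with ∈-map⁻ _ xv∈
  ... | _ , v∈ , refl = v∈ , λ _ → refl

  extend-unique : (Q? : Dec Q) {vs : List (Vec Bool k)} → Unique vs → Unique (extend Q? vs)
  extend-unique (yes _) vs! = Unique.++⁺ (Unique.map⁺ ∷-injectiveʳ vs!) (Unique.map⁺ ∷-injectiveʳ vs!) disjoint
    where
    disjoint : ∀ {v} → ¬ (v ∈ map (false ∷ᵥ_) _ × v ∈ map (true ∷ᵥ_) _)
    disjoint (v∈ , v∈′) with ∈-map⁻ (false ∷ᵥ_) v∈ | ∈-map⁻ (true ∷ᵥ_) v∈′
    ... | _ , _ , refl | _ , _ , ()
  extend-unique (no _) vs! = Unique.map⁺ ∷-injectiveʳ vs!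

subvectors : {k : ℕ} {P : Fin k → Set} → Decidable P → List (Vec Bool k)
subvectors {zero} P? = [ []ᵥ ]
subvectors {suc k} P? = extend (P? zero) (subvectors (P? ∘ suc))

∈-subvectors⁺ : {k : ℕ} {P : Fin k → Set} (P? : Decidable P) {b : Vec Bool k} →
  SupportedOn P b → b ∈ subvectors P?
∈-subvectors⁺ P? {[]ᵥ} _ = here refl
∈-subvectors⁺ P? {x ∷ᵥ b} b-supp =
  ∈-extend⁺ (P? zero) (b-supp zero) (∈-subvectors⁺ (P? ∘ suc) (b-supp ∘ suc))

∈-subvectors⁻ : {k : ℕ} {P : Fin k → Set} (P? : Decidable P) {b : Vec Bool k} →
  b ∈ subvectors P? → SupportedOn P b
∈-subvectors⁻ P? {x ∷ᵥ b} b∈ with ∈-extend⁻ (P? zero) b∈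
... | b∈′ , x-supp = λ { zero → x-supp ; (suc i) → ∈-subvectors⁻ (P? ∘ suc) b∈′ i }

subvectors-unique : {k : ℕ} {P : Fin k → Set} (P? : Decidable P) → Unique (subvectors P?)
subvectors-unique {zero} P? = [] ∷ []
subvectors-unique {suc k} P? = extend-unique (P? zero) (subvectors-unique (P? ∘ suc))

length-subvectors : {k : ℕ} {P : Fin k → Set} (P? : Decidable P) →
  length (subvectors P?) ≡ 2 ^ length (filter P? (allFin k))
length-subvectors {zero} P? = refl
length-subvectors {suc k} P? with P? zero
... | yes _ = begin
  length (map (false ∷ᵥ_) rest ++ map (true ∷ᵥ_) rest)  ≡⟨ length-++ (map (false ∷ᵥ_) rest) ⟩
  length (map (false ∷ᵥ_) rest) + length (map (true ∷ᵥ_) rest)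
    ≡⟨ cong₂ _+_ (length-map _ rest) (trans (length-map _ rest) (sym (+-identityʳ _))) ⟩
  length rest + (length rest + 0)                       ≡⟨ cong (λ l → l + (l + 0)) count-rest ⟩
  2 ^ suc (length (filter P? (List.tabulate suc)))           ∎
  where
  open ≡-Reasoning
  rest = subvectors (P? ∘ suc)
  count-rest : length rest ≡ 2 ^ length (filter P? (List.tabulate suc))
  count-rest = trans (length-subvectors (P? ∘ suc)) (cong (2 ^_) (sym (length-filter-tabulate P? suc)))
... | no _ = trans (length-map _ (subvectors (P? ∘ suc)))
                   (trans (length-subvectors (P? ∘ suc)) (cong (2 ^_) (sym (length-filter-tabulate P? suc))))

module Occurrences {A : Set} (_≟_ : DecidableEquality A) where

  count : A → List A → ℕ
  count x xs = length (filter (_≟ x) xs)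

  module _ {x : A} where

    count-++ : ∀ xs ys → count x (xs ++ ys) ≡ count x xs + count x ys
    count-++ xs ys = trans (cong length (filter-++ (_≟ x) xs ys)) (length-++ (filter (_≟ x) xs))

    count-replicate-≡ : ∀ k → count x (replicate k x) ≡ k
    count-replicate-≡ zero = refl
    count-replicate-≡ (suc k) with x ≟ x
    ... | yes _ = cong suc (count-replicate-≡ k)
    ... | no x≢x = ⊥-elim (x≢x refl)

    count-replicate-≢ : ∀ {y} k → y ≢ x → count x (replicate k y) ≡ 0
    count-replicate-≢ zero _ = refl
    count-replicate-≢ {y} (suc k) y≢x with y ≟ x
    ... | yes y≡x = ⊥-elim (y≢x y≡x)
    ... | no _ = count-replicate-≢ k y≢x

    module _ (f : A → ℕ) where

      count-concatMap-replicate-∉ : ∀ {ys} → x ∉ ys → count x (concatMap (λ y → replicate (f y) y) ys) ≡ 0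
      count-concatMap-replicate-∉ {[]} _ = refl
      count-concatMap-replicate-∉ {y ∷ ys} x∉ = trans (count-++ (replicate (f y) y) _)
        (cong₂ _+_ (count-replicate-≢ (f y) (λ y≡x → x∉ (here (sym y≡x))))
                   (count-concatMap-replicate-∉ (x∉ ∘ there)))

      count-concatMap-replicate : ∀ {ys} → Unique ys → x ∈ ys →
        count x (concatMap (λ y → replicate (f y) y) ys) ≡ f x
      count-concatMap-replicate {y ∷ ys} (y∉ys ∷ _) (here refl) = trans (count-++ (replicate (f x) x) _)
        (trans (cong₂ _+_ (count-replicate-≡ (f x))
                          (count-concatMap-replicate-∉ (λ x∈ → All.lookup y∉ys x∈ refl)))
               (+-identityʳ (f x)))
      count-concatMap-replicate {y ∷ ys} (y∉ys ∷ ys!) (there x∈) = trans (count-++ (replicate (f y) y) _)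
        (cong₂ _+_ (count-replicate-≢ (f y) (λ { refl → All.lookup y∉ys x∈ refl }))
                   (count-concatMap-replicate ys! x∈))

-- A map `Bool → Maybe A` is a pair of optional elements (the two slots of a
-- vertex); `IsSwap c s t` says that t is s, swapped when c.
module OptionalPairs {A : Set} (_≟_ : DecidableEquality A) where

  open Occurrences _≟_

  _≟?_ : DecidableEquality (Maybe A)
  _≟?_ = ≡-dec-Maybe _≟_

  firstTwo : List A → Bool → Maybe A
  firstTwo xs false = head xs
  firstTwo xs true = head (drop 1 xs)

  firstTwo-true-nothing : ∀ {xs} → length xs ≤ 1 → firstTwo xs true ≡ nothing
  firstTwo-true-nothing {[]} _ = refl
  firstTwo-true-nothing {_ ∷ []} _ = refl
  firstTwo-true-nothing {_ ∷ _ ∷ _} (s≤s ())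

  firstTwo-nothing : ∀ {xs} → firstTwo xs false ≡ nothing → firstTwo xs true ≡ nothing
  firstTwo-nothing {[]} _ = refl

  mult : (Bool → Maybe A) → Maybe A → ℕ
  mult s x = indicator (s false ≟? x) + indicator (s true ≟? x)

  IsSwap : Bool → (Bool → Maybe A) → (Bool → Maybe A) → Set
  IsSwap c s t = ∀ p → s (p xor c) ≡ t p

  module _ {s : Bool → Maybe A} {x : Maybe A} where

    mult-at : ∀ i → mult s x ≡ indicator (s i ≟? x) + indicator (s (not i) ≟? x)
    mult-at false = refl
    mult-at true = +-comm (indicator (s false ≟? x)) (indicator (s true ≟? x))

    mult-≢0 : ∀ {i} → s i ≡ x → mult s x ≢ 0
    mult-≢0 {i} sᵢ≡x mult≡0 = 1+n≢0 (begin
      1 + indicator (s (not i) ≟? x)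
        ≡⟨ cong (_+ indicator (s (not i) ≟? x)) (sym (indicator-yes (s i ≟? x) sᵢ≡x)) ⟩
      indicator (s i ≟? x) + indicator (s (not i) ≟? x)      ≡⟨ sym (mult-at i) ⟩
      mult s x                                                ≡⟨ mult≡0 ⟩
      0                                                       ∎)
      where open ≡-Reasoning

    ∈-of-mult-≢0 : mult s x ≢ 0 → ∃ λ k → s k ≡ x
    ∈-of-mult-≢0 ≢0 with indicator-sum-≢0 (s false ≟? x) (s true ≟? x) ≢0
    ... | inj₁ s₀≡x = false , s₀≡x
    ... | inj₂ s₁≡x = true , s₁≡x

    mult-other : ∀ {i} → mult s x ≢ 0 → s i ≢ x → s (not i) ≡ x
    mult-other {i} ≢0 sᵢ≢x with indicator-sum-≢0 (s i ≟? x) (s (not i) ≟? x) (≢0 ∘ trans (mult-at i))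
    ... | inj₁ sᵢ≡x = ⊥-elim (sᵢ≢x sᵢ≡x)
    ... | inj₂ s¬ᵢ≡x = s¬ᵢ≡x

    mult-≡2 : mult s x ≡ 2 → ∀ i → s i ≡ x
    mult-≡2 ≡2 false = proj₁ (indicator-sum-≡2 (s false ≟? x) (s true ≟? x) ≡2)
    mult-≡2 ≡2 true = proj₂ (indicator-sum-≡2 (s false ≟? x) (s true ≟? x) ≡2)

    mult-≡2⁺ : s false ≡ x → s true ≡ x → mult s x ≡ 2
    mult-≡2⁺ s₀≡x s₁≡x =
      cong₂ _+_ (indicator-yes (s false ≟? x) s₀≡x) (indicator-yes (s true ≟? x) s₁≡x)

  mult-firstTwo : ∀ {xs x} → length xs ≤ 2 → mult (firstTwo xs) (just x) ≡ count x xs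
  mult-firstTwo {[]} _ = refl
  mult-firstTwo {y ∷ []} {x} _ with y ≟ x
  ... | yes _ = refl
  ... | no _ = refl
  mult-firstTwo {y ∷ z ∷ []} {x} _ with y ≟ x
  ... | yes _ = cong suc (trans (sym (+-identityʳ _)) (mult-firstTwo {z ∷ []} {x} (s≤s z≤n)))
  ... | no _ = trans (sym (+-identityʳ _)) (mult-firstTwo {z ∷ []} {x} (s≤s z≤n))
  mult-firstTwo {_ ∷ _ ∷ _ ∷ _} (s≤s (s≤s ()))

  mult-swap : ∀ {c s t x} → IsSwap c s t → mult t x ≡ mult s x
  mult-swap {false} {s} {t} {x} swap = cong₂ _+_ (cong (λ y → indicator (y ≟? x)) (sym (swap false)))
                                                (cong (λ y → indicator (y ≟? x)) (sym (swap true)))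
  mult-swap {true} {s} {t} {x} swap = trans (cong₂ _+_ (cong (λ y → indicator (y ≟? x)) (sym (swap false)))
                                                      (cong (λ y → indicator (y ≟? x)) (sym (swap true))))
                                            (+-comm (indicator (s true ≟? x)) (indicator (s false ≟? x)))

  ≡-of-just-indicators : {m m′ : Maybe A} →
    (∀ a → indicator (m ≟? just a) ≡ indicator (m′ ≟? just a)) → m ≡ m′
  ≡-of-just-indicators {just a} {m′} same =
    from-indicator (m′ ≟? just a) (trans (sym (same a)) (indicator-yes (just a ≟? just a) refl))
    where
    from-indicator : (d : Dec (m′ ≡ just a)) → indicator d ≡ 1 → just a ≡ m′
    from-indicator (yes m′≡a) _ = sym m′≡a
    from-indicator (no _) ()
  ≡-of-just-indicators {nothing} {nothing} same = refl
  ≡-of-just-indicators {nothing} {just a′} same =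
    case trans (same a′) (indicator-yes (just a′ ≟? just a′) refl) of λ ()

  module _ {s t : Bool → Maybe A} where

    private
      SameJustMults : Set
      SameJustMults = ∀ a → mult t (just a) ≡ mult s (just a)

      complement-match : SameJustMults → ∀ {j k} → t j ≡ s k → t (not j) ≡ s (not k)
      complement-match same {j} {k} tⱼ≡sₖ = ≡-of-just-indicators λ a →
        +-cancelˡ-≡ (indicator (t j ≟? just a)) _ _ (begin
          indicator (t j ≟? just a) + indicator (t (not j) ≟? just a) ≡⟨ sym (mult-at {t} j) ⟩
          mult t (just a)                                            ≡⟨ same a ⟩
          mult s (just a)                                            ≡⟨ mult-at {s} k ⟩
          indicator (s k ≟? just a) + indicator (s (not k) ≟? just a)
            ≡⟨ cong (λ y → indicator (y ≟? just a) + _) (sym tⱼ≡sₖ) ⟩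
          indicator (t j ≟? just a) + indicator (s (not k) ≟? just a) ∎)
        where open ≡-Reasoning

      some-match : SameJustMults → ∃₂ λ j k → t j ≡ s k
      some-match same = search (t false) refl (t true) refl (s false) refl
        where
        match-at : ∀ {j a} → t j ≡ just a → ∃₂ λ j′ k → t j′ ≡ s k
        match-at {j} {a} tⱼ≡a with ∈-of-mult-≢0 {s} (subst (_≢ 0) (same a) (mult-≢0 {t} tⱼ≡a))
        ... | k , sₖ≡a = j , k , trans tⱼ≡a (sym sₖ≡a)
        search : ∀ m₀ → t false ≡ m₀ → ∀ m₁ → t true ≡ m₁ → ∀ n₀ → s false ≡ n₀ →
          ∃₂ λ j k → t j ≡ s k
        search (just a) t₀ _ _ _ _ = match-at t₀
        search nothing _ (just a) t₁ _ _ = match-at t₁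
        search nothing t₀ nothing _ nothing s₀ = false , false , trans t₀ (sym s₀)
        search nothing t₀ nothing t₁ (just a) s₀ = ⊥-elim (mult-≢0 {s} s₀ (trans (sym (same a)) none))
          where
          none : mult t (just a) ≡ 0
          none rewrite t₀ | t₁ = refl

      swap-of-match : ∀ {j k} → t j ≡ s k → t (not j) ≡ s (not k) → IsSwap (j xor k) s t
      swap-of-match {false} {false} tⱼ≡sₖ _ false = sym tⱼ≡sₖ
      swap-of-match {false} {false} _ t¬ⱼ≡s¬ₖ true = sym t¬ⱼ≡s¬ₖ
      swap-of-match {false} {true} tⱼ≡sₖ _ false = sym tⱼ≡sₖ
      swap-of-match {false} {true} _ t¬ⱼ≡s¬ₖ true = sym t¬ⱼ≡s¬ₖ
      swap-of-match {true} {false} _ t¬ⱼ≡s¬ₖ false = sym t¬ⱼ≡s¬ₖ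
      swap-of-match {true} {false} tⱼ≡sₖ _ true = sym tⱼ≡sₖ
      swap-of-match {true} {true} _ t¬ⱼ≡s¬ₖ false = sym t¬ⱼ≡s¬ₖ
      swap-of-match {true} {true} tⱼ≡sₖ _ true = sym tⱼ≡sₖ

    swap-of-same-mults : (∀ a → mult t (just a) ≡ mult s (just a)) → ∃ λ c → IsSwap c s t
    swap-of-same-mults same with some-match same
    ... | j , k , tⱼ≡sₖ = j xor k , swap-of-match tⱼ≡sₖ (complement-match same tⱼ≡sₖ)

    swap-unique : ∀ {c} → s false ≢ s true → IsSwap c s t → c ≡ not (does (s false ≟? t false))
    swap-unique {false} _ swap with s false ≟? t false
    ... | yes _ = refl
    ... | no s₀≢t₀ = ⊥-elim (s₀≢t₀ (swap false))
    swap-unique {true} s₀≢s₁ swap with s false ≟? t false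
    ... | yes s₀≡t₀ = ⊥-elim (s₀≢s₁ (trans s₀≡t₀ (sym (swap false))))
    ... | no _ = refl

    swap-of-constant : ∀ {c} c′ → s false ≡ s true → IsSwap c s t → IsSwap c′ s t
    swap-of-constant {c} c′ s₀≡s₁ swap p = trans (constant (p xor c′) (p xor c)) (swap p)
      where
      constant : ∀ i j → s i ≡ s j
      constant false false = refl
      constant false true = s₀≡s₁
      constant true false = sym s₀≡s₁
      constant true true = refl

    swap-false : ∀ {c} → s true ≡ t true → IsSwap c s t → IsSwap false s t
    swap-false {false} _ swap = swap
    swap-false {true} s₁≡t₁ swap false = trans (swap true) (trans (sym s₁≡t₁) (swap false))
    swap-false {true} s₁≡t₁ swap true = s₁≡t₁

-- The blocks of [n]

pos : ℕ → Bool → ℕ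
pos zero false = 0
pos zero true = 1
pos (suc j) p = suc (suc (pos j p))

parity : ℕ → Bool
parity zero = false
parity (suc zero) = true
parity (suc (suc k)) = parity k

⌊pos/2⌋≡ : ∀ j p → ⌊ pos j p /2⌋ ≡ j
⌊pos/2⌋≡ zero false = refl
⌊pos/2⌋≡ zero true = refl
⌊pos/2⌋≡ (suc j) p = cong suc (⌊pos/2⌋≡ j p)

parity-pos : ∀ j p → parity (pos j p) ≡ p
parity-pos zero false = refl
parity-pos zero true = refl
parity-pos (suc j) p = parity-pos j p

pos-⌊/2⌋-parity : ∀ k → pos ⌊ k /2⌋ (parity k) ≡ k
pos-⌊/2⌋-parity zero = refl
pos-⌊/2⌋-parity (suc zero) = refl
pos-⌊/2⌋-parity (suc (suc k)) = cong (λ k′ → suc (suc k′)) (pos-⌊/2⌋-parity k)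

pos-false-< : ∀ j n → j < ⌈ n /2⌉ → pos j false < n
pos-false-< zero (suc n) _ = s≤s z≤n
pos-false-< (suc j) (suc zero) (s≤s ())
pos-false-< (suc j) (suc (suc n)) (s≤s j<) = s≤s (s≤s (pos-false-< j n j<))

pos-true-<⇒ : ∀ j n → pos j true < n → j < ⌊ n /2⌋
pos-true-<⇒ zero (suc zero) (s≤s ())
pos-true-<⇒ zero (suc (suc n)) _ = s≤s z≤n
pos-true-<⇒ (suc j) (suc (suc n)) (s≤s (s≤s p<)) = s≤s (pos-true-<⇒ j n p<)

pos-true-<⇐ : ∀ j n → j < ⌊ n /2⌋ → pos j true < n
pos-true-<⇐ zero (suc (suc n)) _ = s≤s (s≤s z≤n)
pos-true-<⇐ (suc j) (suc (suc n)) (s≤s j<) = s≤s (s≤s (pos-true-<⇐ j n j<))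

pos-true-≮⇒≡⌊/2⌋ : ∀ j n → j < ⌈ n /2⌉ → ¬ pos j true < n → j ≡ ⌊ n /2⌋
pos-true-≮⇒≡⌊/2⌋ zero (suc zero) _ _ = refl
pos-true-≮⇒≡⌊/2⌋ (suc j) (suc zero) (s≤s ()) _
pos-true-≮⇒≡⌊/2⌋ zero (suc (suc n)) _ ≮ = ⊥-elim (≮ (s≤s (s≤s z≤n)))
pos-true-≮⇒≡⌊/2⌋ (suc j) (suc (suc n)) (s≤s j<) ≮ =
  cong suc (pos-true-≮⇒≡⌊/2⌋ j n j< (≮ ∘ s≤s ∘ s≤s))

-- Element (u , p) of the block of u is the one of parity p; the block of
-- the last vertex of an odd n has no element of parity true.
module _ {n : ℕ} where

  Elt : Vtx n → Bool → Set
  Elt u p = pos (toℕ u) p < n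

  Elt? : ∀ u p → Dec (Elt u p)
  Elt? u p = pos (toℕ u) p <? n

  Full : Vtx n → Set
  Full u = Elt u true

  Elt-false : ∀ u → Elt u false
  Elt-false u = pos-false-< (toℕ u) n (toℕ<n u)

  Elt-of-Full : ∀ {u} → Full u → ∀ p → Elt u p
  Elt-of-Full {u} _ false = Elt-false u
  Elt-of-Full full true = full

  Elt-¬Full : ∀ {u p} → Elt u p → ¬ Full u → p ≡ false
  Elt-¬Full {p = false} _ _ = refl
  Elt-¬Full {p = true} full ¬full = ⊥-elim (¬full full)

  ¬Full⇒last : ∀ {u} → ¬ Full u → toℕ u ≡ ⌊ n /2⌋
  ¬Full⇒last {u} = pos-true-≮⇒≡⌊/2⌋ (toℕ u) n (toℕ<n u)

  -- junk value el u true = el u false when u is not full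
  el : Vtx n → Bool → Fin n
  el u p with Elt? u p
  ... | yes elt = fromℕ< elt
  ... | no _ = fromℕ< (Elt-false u)

  toℕ-el : ∀ {u p} → Elt u p → toℕ (el u p) ≡ pos (toℕ u) p
  toℕ-el {u} {p} elt with Elt? u p
  ... | yes _ = toℕ-fromℕ< _
  ... | no ¬elt = ⊥-elim (¬elt elt)

  par : Fin n → Bool
  par a = parity (toℕ a)

  toℕ-block : (a : Fin n) → toℕ (block a) ≡ ⌊ toℕ a /2⌋
  toℕ-block a = toℕ-fromℕ< _

  block-el : ∀ {u p} → Elt u p → block (el u p) ≡ u
  block-el {u} {p} elt = toℕ-injective (begin
    toℕ (block (el u p))   ≡⟨ toℕ-block (el u p) ⟩
    ⌊ toℕ (el u p) /2⌋     ≡⟨ cong ⌊_/2⌋ (toℕ-el elt) ⟩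
    ⌊ pos (toℕ u) p /2⌋    ≡⟨ ⌊pos/2⌋≡ (toℕ u) p ⟩
    toℕ u                  ∎)
    where open ≡-Reasoning

  par-el : ∀ {u p} → Elt u p → par (el u p) ≡ p
  par-el {u} {p} elt = trans (cong parity (toℕ-el elt)) (parity-pos (toℕ u) p)

  pos-block-par : (a : Fin n) → pos (toℕ (block a)) (par a) ≡ toℕ a
  pos-block-par a = trans (cong (λ j → pos j (par a)) (toℕ-block a)) (pos-⌊/2⌋-parity (toℕ a))

  Elt-block-par : (a : Fin n) → Elt (block a) (par a)
  Elt-block-par a = subst (_< n) (sym (pos-block-par a)) (toℕ<n a)

  el-block-par : (a : Fin n) → el (block a) (par a) ≡ a
  el-block-par a = toℕ-injective (trans (toℕ-el (Elt-block-par a)) (pos-block-par a))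


  ≡-of-block-par : ∀ {a a′ : Fin n} → block a ≡ block a′ → par a ≡ par a′ → a ≡ a′
  ≡-of-block-par {a} {a′} block≡ par≡ =
    trans (sym (el-block-par a)) (trans (cong₂ el block≡ par≡) (el-block-par a′))

  el-of-block : ∀ {u : Vtx n} {a} → block a ≡ u → el u (par a) ≡ a
  el-of-block {a = a} refl = el-block-par a

  Elt-of-block : ∀ {u : Vtx n} {a} → block a ≡ u → Elt u (par a)
  Elt-of-block {a = a} refl = Elt-block-par a

module _ {n : ℕ} (G : MGraph n) (G∈𝔊 : InG n G) where

  open InG G∈𝔊
  open Occurrences (_≟ᶠ_ {⌈ n /2⌉})
  open OptionalPairs (_≟ᶠ_ {⌈ n /2⌉})

  neighbours : Vtx n → List (Vtx n)
  neighbours u = concatMap (λ w → replicate (G u w) w) (allFin _)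

  opaque
    -- the (at most two) neighbours of u, listed with multiplicity
    slot : Vtx n → Bool → Maybe (Vtx n)
    slot u = firstTwo (neighbours u)

    length-neighbours : ∀ u → length (neighbours u) ≡ degree G u
    length-neighbours u = length-concatMap-replicate (G u) (allFin _)

    mult-slot : ∀ u w → mult (slot u) (just w) ≡ G u w
    mult-slot u w = trans (mult-firstTwo {neighbours u} {w} (subst (_≤ 2) (sym (length-neighbours u)) (degAtMost2 u)))
                          (count-concatMap-replicate (G u) (Unique.allFin⁺ _) (∈-allFin w))

    slot-true-¬Full : ∀ {u} → ¬ Full u → slot u true ≡ nothing
    slot-true-¬Full {u} ¬full =
      firstTwo-true-nothing {neighbours u} (subst (_≤ 1) (sym (length-neighbours u)) (lastDeg u (¬Full⇒last ¬full)))

    slot-isolated : ∀ {u} → slot u false ≡ nothing → ∀ i → slot u i ≡ nothing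
    slot-isolated s₀ false = s₀
    slot-isolated {u} s₀ true = firstTwo-nothing {neighbours u} s₀

  slot-loopless : ∀ u i → slot u i ≢ just u
  slot-loopless u i sᵢ≡u = mult-≢0 {slot u} {just u} {i} sᵢ≡u (trans (mult-slot u u) (loopless u))

  mult-slot-sym : ∀ u w → mult (slot u) (just w) ≡ mult (slot w) (just u)
  mult-slot-sym u w = trans (mult-slot u w) (trans (symmetric u w) (sym (mult-slot w u)))

  Elt-of-slot : ∀ {u i w} → slot u i ≡ just w → Elt u i
  Elt-of-slot {u} {false} _ = Elt-false u
  Elt-of-slot {u} {true} s₁≡w with Elt? u true
  ... | yes full = full
  ... | no ¬full = case trans (sym (slot-true-¬Full ¬full)) s₁≡w of λ ()

  2-cycle-slot : ∀ {u w} → G u w ≡ 2 → ∀ i → slot u i ≡ just w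
  2-cycle-slot {u} {w} 2-cycle = mult-≡2 {slot u} (trans (mult-slot u w) 2-cycle)

  2-cycle-of-slots : ∀ {u w i} → slot u i ≡ just w → slot u (not i) ≡ just w → G u w ≡ 2
  2-cycle-of-slots {u} {w} {false} s₀ s₁ = trans (sym (mult-slot u w)) (mult-≡2⁺ {slot u} s₀ s₁)
  2-cycle-of-slots {u} {w} {true} s₁ s₀ = trans (sym (mult-slot u w)) (mult-≡2⁺ {slot u} s₀ s₁)

  slot-false-of-both : ∀ {u i} → slot u i ≡ nothing → slot u (not i) ≡ nothing → slot u false ≡ nothing
  slot-false-of-both {i = false} s₀ _ = s₀
  slot-false-of-both {i = true} _ s₀ = s₀

  -- the slot of w matched with slot i of u, when slot i of u holds w
  partnerSlot : Vtx n → Bool → Vtx n → Bool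
  partnerSlot u i w = if does (slot w i ≟? just u) then i else not i

  slot-partnerSlot : ∀ {u i w} → slot u i ≡ just w → slot w (partnerSlot u i w) ≡ just u
  slot-partnerSlot {u} {i} {w} sᵢ≡w with slot w i ≟? just u
  ... | yes back = back
  ... | no ¬back =
    mult-other {slot w} {just u} {i} (subst (_≢ 0) (mult-slot-sym u w) (mult-≢0 {slot u} {just w} {i} sᵢ≡w)) ¬back

  partnerSlot-involutive : ∀ {u i w} → slot u i ≡ just w → partnerSlot w (partnerSlot u i w) u ≡ i
  partnerSlot-involutive {u} {i} {w} sᵢ≡w with slot w i ≟? just u
  ... | yes _ with slot u i ≟? just w
  ...   | yes _ = refl
  ...   | no ¬sᵢ≡w = ⊥-elim (¬sᵢ≡w sᵢ≡w)
  partnerSlot-involutive {u} {i} {w} sᵢ≡w | no ¬back with slot u (not i) ≟? just w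
  ...   | yes s¬ᵢ≡w =
    ⊥-elim (¬back (2-cycle-slot (trans (symmetric w u) (2-cycle-of-slots {i = i} sᵢ≡w s¬ᵢ≡w)) i))
  ...   | no _ = not-involutive i

  partnerSlot-back : ∀ {u i w} → slot w i ≡ just u → partnerSlot u i w ≡ i
  partnerSlot-back {u} {i} {w} sᵢ≡u with slot w i ≟? just u
  ... | yes _ = refl
  ... | no ¬sᵢ≡u = ⊥-elim (¬sᵢ≡u sᵢ≡u)

  partnerSlot-unique : ∀ {u i w j} → slot u i ≡ just w → slot w j ≡ just u →
    partnerSlot u i w ≡ j ⊎ G w u ≡ 2
  partnerSlot-unique {u} {i} {w} {j} _ sⱼ≡u with slot w i ≟? just u | i Data.Bool.≟ j
  ... | yes _ | yes i≡j = inj₁ i≡j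
  ... | yes sᵢ≡u | no i≢j =
    inj₂ (2-cycle-of-slots {i = i} sᵢ≡u (subst (λ k → slot w k ≡ just u) (¬-not (i≢j ∘ sym)) sⱼ≡u))
  ... | no ¬sᵢ≡u | _ = inj₁ (sym (¬-not λ j≡i → ¬sᵢ≡u (subst (λ k → slot w k ≡ just u) j≡i sⱼ≡u)))

  away : Vtx n → Vtx n → Maybe (Vtx n)
  away u d = if does (d ≟ᶠ u) then nothing else just d

  away-self : ∀ u → away u u ≡ nothing
  away-self u with u ≟ᶠ u
  ... | yes _ = refl
  ... | no u≢u = ⊥-elim (u≢u refl)

  away-other : ∀ {u d} → d ≢ u → away u d ≡ just d
  away-other {u} {d} d≢u with d ≟ᶠ u
  ... | yes d≡u = ⊥-elim (d≢u d≡u)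
  ... | no _ = refl

  away-nothing : ∀ {u d} → away u d ≡ nothing → d ≡ u
  away-nothing {u} {d} _ with d ≟ᶠ u
  away-nothing _ | yes d≡u = d≡u

  away-just : ∀ {u d w} → away u d ≡ just w → d ≡ w
  away-just {u} {d} _ with d ≟ᶠ u
  away-just refl | no _ = refl

  indicator-away : ∀ {u w} d → u ≢ w → indicator (away u d ≟? just w) ≡ indicator (d ≟ᶠ w)
  indicator-away {u} {w} d u≢w with d ≟ᶠ u | d ≟ᶠ w
  ... | yes refl | yes refl = ⊥-elim (u≢w refl)
  ... | yes _ | no _ = refl
  ... | no _ | yes refl = indicator-yes (just d ≟? just d) refl
  ... | no _ | no d≢w = indicator-no (just d ≟? just w) (d≢w ∘ just-injective)

  -- where the element (u , p) is sent by f, seen from u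
  targetWith : (Fin n → Fin n) → ∀ u p → Dec (Elt u p) → Maybe (Vtx n)
  targetWith f u p (yes _) = away u (block (f (el u p)))
  targetWith f u p (no _) = nothing

  target : (Fin n → Fin n) → Vtx n → Bool → Maybe (Vtx n)
  target f u p = targetWith f u p (Elt? u p)

  module _ {f : Fin n → Fin n} {u : Vtx n} {p : Bool} where

    target-Elt : Elt u p → target f u p ≡ away u (block (f (el u p)))
    target-Elt elt = go (Elt? u p)
      where
      go : (elt? : Dec (Elt u p)) → targetWith f u p elt? ≡ away u (block (f (el u p)))
      go (yes _) = refl
      go (no ¬elt) = ⊥-elim (¬elt elt)

    target-¬Elt : ¬ Elt u p → target f u p ≡ nothing
    target-¬Elt ¬elt = go (Elt? u p)
      where
      go : (elt? : Dec (Elt u p)) → targetWith f u p elt? ≡ nothing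
      go (yes elt) = ⊥-elim (¬elt elt)
      go (no _) = refl

  target-cong : ∀ {f g : Fin n → Fin n} → (∀ a → f a ≡ g a) → ∀ u p → target f u p ≡ target g u p
  target-cong {f} {g} f≗g u p = go (Elt? u p)
    where
    go : (elt? : Dec (Elt u p)) → targetWith f u p elt? ≡ targetWith g u p elt?
    go (yes _) = cong (away u ∘ block) (f≗g (el u p))
    go (no _) = refl

  target-≢-self : ∀ f u p → target f u p ≢ just u
  target-≢-self f u p = go (Elt? u p)
    where
    go : (elt? : Dec (Elt u p)) → targetWith f u p elt? ≢ just u
    go (yes _) t≡u = case trans (sym (away-self u)) (subst (λ d → away u d ≡ just u) (away-just t≡u) t≡u) of λ ()
    go (no _) ()

  eltsWith : ∀ u p → Dec (Elt u p) → List (Fin n)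
  eltsWith u p (yes _) = [ el u p ]
  eltsWith u p (no _) = []

  blockElts : Vtx n → List (Fin n)
  blockElts u = eltsWith u false (Elt? u false) ++ eltsWith u true (Elt? u true)

  ∈-blockElts : (a : Fin n) → a ∈ blockElts (block a)
  ∈-blockElts a = subst (_∈ blockElts (block a)) (el-block-par a) (∈-blockElts-el (Elt-block-par a))
    where
    ∈-eltsWith : ∀ {u p} (elt? : Dec (Elt u p)) → Elt u p → el u p ∈ eltsWith u p elt?
    ∈-eltsWith (yes _) _ = here refl
    ∈-eltsWith (no ¬elt) elt = ⊥-elim (¬elt elt)
    ∈-blockElts-el : ∀ {u p} → Elt u p → el u p ∈ blockElts u
    ∈-blockElts-el {u} {false} elt = ∈-++⁺ˡ (∈-eltsWith (Elt? u false) elt)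
    ∈-blockElts-el {u} {true} elt = ∈-++⁺ʳ (eltsWith u false (Elt? u false)) (∈-eltsWith (Elt? u true) elt)

  block-∈-eltsWith : ∀ {u p a} (elt? : Dec (Elt u p)) → a ∈ eltsWith u p elt? → block a ≡ u
  block-∈-eltsWith (yes elt) (here refl) = block-el elt

  block-∈-blockElts : ∀ {u a} → a ∈ blockElts u → block a ≡ u
  block-∈-blockElts {u} a∈ with ∈-++⁻ (eltsWith u false (Elt? u false)) a∈
  ... | inj₁ a∈₀ = block-∈-eltsWith (Elt? u false) a∈₀
  ... | inj₂ a∈₁ = block-∈-eltsWith (Elt? u true) a∈₁

  blockElts-unique : ∀ u → Unique (blockElts u)
  blockElts-unique u = unique (Elt? u false) (Elt? u true)
    where
    unique : (elt₀? : Dec (Elt u false)) (elt₁? : Dec (Elt u true)) →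
      Unique (eltsWith u false elt₀? ++ eltsWith u true elt₁?)
    unique (yes elt₀) (yes elt₁) = (el₀≢el₁ ∷ []) ∷ [] ∷ []
      where
      el₀≢el₁ : el u false ≢ el u true
      el₀≢el₁ el₀≡el₁ = case trans (sym (par-el elt₀)) (trans (cong par el₀≡el₁) (par-el elt₁)) of λ ()
    unique (yes _) (no _) = [] ∷ []
    unique (no _) (yes _) = [] ∷ []
    unique (no _) (no _) = []

  Γ-diagonal : ∀ (π : Vec (Fin n) n) {u w : Vtx n} → u ≡ w → Γ π u w ≡ 0
  Γ-diagonal π {u} {w} u≡w with toℕ u ≟ⁿ toℕ w
  ... | yes _ = refl
  ... | no toℕu≢toℕw = ⊥-elim (toℕu≢toℕw (cong toℕ u≡w))

  Γ≡mult-target : ∀ (π : Vec (Fin n) n) {u w : Vtx n} → u ≢ w → Γ π u w ≡ mult (target (lookup π) u) (just w)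
  Γ≡mult-target π {u} {w} u≢w with toℕ u ≟ⁿ toℕ w
  ... | yes toℕu≡toℕw = ⊥-elim (u≢w (toℕ-injective toℕu≡toℕw))
  ... | no _ = begin
    length (filter P? (allFin n))
      ≡⟨ length-≡-of-same-elements (Unique.filter⁺ P? (Unique.allFin⁺ n))
                                   (Unique.filter⁺ Q? (blockElts-unique u)) to from ⟩
    length (filter Q? (eltsWith u false (Elt? u false) ++ eltsWith u true (Elt? u true)))
      ≡⟨ cong length (filter-++ Q? (eltsWith u false (Elt? u false)) _) ⟩
    length (filter Q? (eltsWith u false (Elt? u false)) ++ filter Q? (eltsWith u true (Elt? u true)))
      ≡⟨ length-++ (filter Q? (eltsWith u false (Elt? u false))) ⟩
    length (filter Q? (eltsWith u false (Elt? u false))) + length (filter Q? (eltsWith u true (Elt? u true)))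
      ≡⟨ cong₂ _+_ (count-eltsWith (Elt? u false)) (count-eltsWith (Elt? u true)) ⟩
    mult (target f u) (just w) ∎
    where
    open ≡-Reasoning
    f = lookup π
    P? = λ a → (block a ≟ᶠ u) ×-dec (block (f a) ≟ᶠ w)
    Q? = λ a → block (f a) ≟ᶠ w
    to : ∀ {a} → a ∈ filter P? (allFin n) → a ∈ filter Q? (blockElts u)
    to a∈ with ∈-filter⁻ P? {xs = allFin n} a∈
    ... | _ , refl , fa∈w = ∈-filter⁺ Q? (∈-blockElts _) fa∈w
    from : ∀ {a} → a ∈ filter Q? (blockElts u) → a ∈ filter P? (allFin n)
    from a∈ with ∈-filter⁻ Q? {xs = blockElts u} a∈
    ... | a∈u , fa∈w = ∈-filter⁺ P? (∈-allFin _) (block-∈-blockElts a∈u , fa∈w)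
    count-eltsWith : ∀ {p} (elt? : Dec (Elt u p)) →
      length (filter Q? (eltsWith u p elt?)) ≡ indicator (targetWith f u p elt? ≟? just w)
    count-eltsWith {p} (yes _) = trans (length-filter-[ el u p ] Q?) (sym (indicator-away (block (f (el u p))) u≢w))
    count-eltsWith (no _) = refl

  UpperEnd : Vtx n → Set
  UpperEnd u = ∃ λ x → toℕ x < toℕ u × G u x ≡ 2

  upperEnd? : ∀ u → Dec (UpperEnd u)
  upperEnd? u = any? λ x → (toℕ x <? toℕ u) ×-dec (G u x ≟ⁿ 2)

  -- the vertices whose bit is a genuine choice
  Free : Vtx n → Set
  Free u = Full u × ¬ UpperEnd u

  free? : ∀ u → Dec (Free u)
  free? u = Elt? u true ×-dec ¬? (upperEnd? u)

  2-cycle-Full : ∀ {u x} → G u x ≡ 2 → Full u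
  2-cycle-Full 2-cycle = Elt-of-slot (2-cycle-slot 2-cycle true)

  2-cycle-irreflexive : ∀ {u x} → G u x ≡ 2 → x ≢ u
  2-cycle-irreflexive {u} 2-cycle refl = slot-loopless u false (2-cycle-slot 2-cycle false)


  2-cycle-constant : ∀ {u x} → G u x ≡ 2 → slot u false ≡ slot u true
  2-cycle-constant 2-cycle = trans (2-cycle-slot 2-cycle false) (sym (2-cycle-slot 2-cycle true))

  2-cycle-unique : ∀ {u x y} → G u x ≡ 2 → G u y ≡ 2 → x ≡ y
  2-cycle-unique ux uy = just-injective (trans (sym (2-cycle-slot ux false)) (2-cycle-slot uy false))

  2-cycle-lower-Free : ∀ {u d} → G u d ≡ 2 → toℕ u < toℕ d → Free u
  2-cycle-lower-Free {u} 2-cycle u<d =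
    2-cycle-Full 2-cycle , λ (y , y<u , uy) → <-asym u<d (subst (λ x → toℕ x < toℕ u) (2-cycle-unique uy 2-cycle) y<u)

  2-cycle-upper-¬Free : ∀ {u d} → G u d ≡ 2 → toℕ d < toℕ u → ¬ Free u
  2-cycle-upper-¬Free 2-cycle d<u (_ , ¬upper) = ¬upper (_ , d<u , 2-cycle)

  2-cycle-Free-end : ∀ {u x} → G u x ≡ 2 → Free u → ¬ Free x
  2-cycle-Free-end {u} {x} 2-cycle free with <-cmp u x
  ... | tri< u<x _ _ = 2-cycle-upper-¬Free (trans (symmetric x u) 2-cycle) u<x
  ... | tri≈ _ refl _ = ⊥-elim (2-cycle-irreflexive 2-cycle refl)
  ... | tri> _ _ x<u = ⊥-elim (2-cycle-upper-¬Free 2-cycle x<u free)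

  -- Decoding bit vectors

  module Decoding (b : Vec Bool ⌈ n /2⌉) where

    B : Vtx n → Bool
    B = lookup b

    route : Vtx n → Bool → Bool → Maybe (Vtx n) → Maybe (Vtx n) → Vtx n × Bool
    route u p i (just w) _ = w , partnerSlot u i w xor B w
    route u p i nothing nothing = u , i
    route u p i nothing (just _) = u , p

    -- The element (u , p) occupies slot p xor B u of u and is sent along it
    -- to the element occupying the partner slot.  An element in an empty
    -- slot stays put, unless u is isolated, where B u chooses between the
    -- identity and the transposition of the block.
    decodeAt : Vtx n → Bool → Vtx n × Bool
    decodeAt u p = route u p (p xor B u) (slot u (p xor B u)) (slot u false)

    decode : Fin n → Fin n
    decode a = uncurry el (decodeAt (block a) (par a))

    module _ {u : Vtx n} {p : Bool} where

      decodeAt-just : ∀ {w} → slot u (p xor B u) ≡ just w → decodeAt u p ≡ (w , partnerSlot u (p xor B u) w xor B w)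
      decodeAt-just sᵢ≡w rewrite sᵢ≡w = refl

      decodeAt-isolated : slot u false ≡ nothing → decodeAt u p ≡ (u , p xor B u)
      decodeAt-isolated s₀≡nothing rewrite slot-isolated s₀≡nothing (p xor B u) | s₀≡nothing = refl

      decodeAt-stay : ∀ {x} → slot u (p xor B u) ≡ nothing → slot u false ≡ just x → decodeAt u p ≡ (u , p)
      decodeAt-stay sᵢ≡nothing s₀≡x rewrite sᵢ≡nothing | s₀≡x = refl

      decode-el : Elt u p → decode (el u p) ≡ uncurry el (decodeAt u p)
      decode-el elt rewrite block-el elt | par-el elt = refl

    module _ (b-supp : SupportedOn Free b) where

      B-¬Full : ∀ {u} → ¬ Full u → B u ≡ false
      B-¬Full ¬full = b-supp _ (¬full ∘ proj₁)

      Elt-xor-B : ∀ {u p} → Elt u p → Elt u (p xor B u)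
      Elt-xor-B {u} {p} elt with Elt? u true
      ... | yes full = Elt-of-Full full _
      ... | no ¬full = subst (Elt u) (sym (trans (cong (p xor_) (B-¬Full ¬full)) (xor-identityʳ p))) elt

      decodeAt-Elt : ∀ {u p} → Elt u p → uncurry Elt (decodeAt u p)
      decodeAt-Elt {u} {p} elt with slot u (p xor B u) in sᵢ | slot u false in s₀
      ... | just w | _ = Elt-xor-B (Elt-of-slot (slot-partnerSlot sᵢ))
      ... | nothing | nothing = Elt-xor-B elt
      ... | nothing | just _ = elt

      decodeAt-involutive : ∀ {u p} → Elt u p → uncurry decodeAt (decodeAt u p) ≡ (u , p)
      decodeAt-involutive {u} {p} elt with slot u (p xor B u) in sᵢ | slot u false in s₀
      ... | just w | _ = begin
        decodeAt w (j xor B w)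
          ≡⟨ decodeAt-just (subst (λ k → slot w k ≡ just u) (sym (xor-cancelʳ j (B w))) (slot-partnerSlot sᵢ)) ⟩
        (u , partnerSlot w ((j xor B w) xor B w) u xor B u)
          ≡⟨ cong (λ k → u , partnerSlot w k u xor B u) (xor-cancelʳ j (B w)) ⟩
        (u , partnerSlot w j u xor B u)   ≡⟨ cong (λ k → u , k xor B u) (partnerSlot-involutive sᵢ) ⟩
        (u , (p xor B u) xor B u)         ≡⟨ cong (u ,_) (xor-cancelʳ p (B u)) ⟩
        (u , p)                           ∎
        where
        open ≡-Reasoning
        j = partnerSlot u (p xor B u) w
      ... | nothing | nothing = trans (decodeAt-isolated s₀) (cong (u ,_) (xor-cancelʳ p (B u)))
      ... | nothing | just _ = decodeAt-stay sᵢ s₀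

      decode-decode : ∀ a → decode (decode a) ≡ a
      decode-decode a = begin
        decode (uncurry el (decodeAt u p))      ≡⟨ decode-el (decodeAt-Elt (Elt-block-par a)) ⟩
        uncurry el (uncurry decodeAt (decodeAt u p)) ≡⟨ cong (uncurry el) (decodeAt-involutive (Elt-block-par a)) ⟩
        el u p                                  ≡⟨ el-block-par a ⟩
        a                                       ∎
        where
        open ≡-Reasoning
        u = block a
        p = par a

      decode-involutive : IsInvolution (tabulate decode)
      decode-involutive a =
        trans (lookup∘tabulate decode _) (trans (cong decode (lookup∘tabulate decode a)) (decode-decode a))

      slot-decodeAt : ∀ {u p} → slot u (p xor B u) ≡ away u (proj₁ (decodeAt u p))
      slot-decodeAt {u} {p} with slot u (p xor B u) in sᵢ | slot u false in s₀
      ... | just w | _ = sym (away-other λ { refl → slot-loopless u (p xor B u) sᵢ })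
      ... | nothing | nothing = sym (away-self u)
      ... | nothing | just _ = sym (away-self u)

      decode-respects-Elt : ∀ {u p} → Elt u p → slot u (p xor B u) ≡ target decode u p
      decode-respects-Elt {u} {p} elt = begin
        slot u (p xor B u)                          ≡⟨ slot-decodeAt ⟩
        away u (proj₁ (decodeAt u p))               ≡⟨ cong (away u) (sym (block-el (decodeAt-Elt elt))) ⟩
        away u (block (uncurry el (decodeAt u p)))  ≡⟨ cong (away u ∘ block) (sym (decode-el elt)) ⟩
        away u (block (decode (el u p)))            ≡⟨ sym (target-Elt elt) ⟩
        target decode u p                           ∎
        where open ≡-Reasoning

      decode-respects-¬Full : ∀ {u} → ¬ Full u → slot u (true xor B u) ≡ target decode u true
      decode-respects-¬Full ¬full rewrite B-¬Full ¬full = trans (slot-true-¬Full ¬full) (sym (target-¬Elt ¬full))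

      decode-respects : ∀ u → IsSwap (B u) (slot u) (target decode u)
      decode-respects u false = decode-respects-Elt (Elt-false u)
      decode-respects u true = go (Elt? u true)
        where
        go : Dec (Full u) → slot u (true xor B u) ≡ target decode u true
        go (yes full) = decode-respects-Elt full
        go (no ¬full) = decode-respects-¬Full ¬full

      decode-Γ : GraphEq (Γ (tabulate decode)) G
      decode-Γ u w = go (u ≟ᶠ w)
        where
        open ≡-Reasoning
        respects : IsSwap (B u) (slot u) (target (lookup (tabulate decode)) u)
        respects p = trans (decode-respects u p) (target-cong (sym ∘ lookup∘tabulate decode) u p)
        go : Dec (u ≡ w) → Γ (tabulate decode) u w ≡ G u w
        go (yes u≡w) = trans (Γ-diagonal (tabulate decode) u≡w) (trans (sym (loopless u)) (cong (G u) u≡w))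
        go (no u≢w) = begin
          Γ (tabulate decode) u w                              ≡⟨ Γ≡mult-target (tabulate decode) u≢w ⟩
          mult (target (lookup (tabulate decode)) u) (just w)  ≡⟨ mult-swap {B u} {slot u} respects ⟩
          mult (slot u) (just w)                               ≡⟨ mult-slot u w ⟩
          G u w                                                ∎

  -- Encoding involutions

  encodeBitWith : (Fin n → Fin n) → ∀ u → Dec (Free u) → Dec (slot u false ≡ slot u true) → Bool
  encodeBitWith f u (no _) _ = false
  encodeBitWith f u (yes _) (yes _) = par (f (el u false))
  encodeBitWith f u (yes _) (no _) = not (does (slot u false ≟? target f u false))

  -- the bit that makes decoding reproduce f at the free vertex u
  encodeBit : (Fin n → Fin n) → Vtx n → Bool
  encodeBit f u = encodeBitWith f u (free? u) (slot u false ≟? slot u true)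

  encode : Vec (Fin n) n → Vec Bool ⌈ n /2⌉
  encode π = tabulate (encodeBit (lookup π))

  module _ {f : Fin n → Fin n} {u : Vtx n} where

    encodeBit-¬Free : ¬ Free u → encodeBit f u ≡ false
    encodeBit-¬Free ¬free = go (free? u) (slot u false ≟? slot u true)
      where
      go : ∀ free? const? → encodeBitWith f u free? const? ≡ false
      go (yes free) _ = ⊥-elim (¬free free)
      go (no _) _ = refl

    encodeBit-constant : Free u → slot u false ≡ slot u true → encodeBit f u ≡ par (f (el u false))
    encodeBit-constant free const = go (free? u) (slot u false ≟? slot u true)
      where
      go : ∀ free? const? → encodeBitWith f u free? const? ≡ par (f (el u false))
      go (yes _) (yes _) = refl
      go (yes _) (no ¬const) = ⊥-elim (¬const const)
      go (no ¬free) _ = ⊥-elim (¬free free)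

    encodeBit-distinct : Free u → slot u false ≢ slot u true →
      encodeBit f u ≡ not (does (slot u false ≟? target f u false))
    encodeBit-distinct free ¬const = go (free? u) (slot u false ≟? slot u true)
      where
      go : ∀ free? const? → encodeBitWith f u free? const? ≡ not (does (slot u false ≟? target f u false))
      go (yes _) (yes const) = ⊥-elim (¬const const)
      go (yes _) (no _) = refl
      go (no ¬free) _ = ⊥-elim (¬free free)

  encodeBit-cong : ∀ {f g : Fin n → Fin n} → (∀ a → f a ≡ g a) → ∀ u → encodeBit f u ≡ encodeBit g u
  encodeBit-cong {f} {g} f≗g u = go (free? u) (slot u false ≟? slot u true)
    where
    go : ∀ free? const? → encodeBitWith f u free? const? ≡ encodeBitWith g u free? const?
    go (no _) _ = refl
    go (yes _) (yes _) = cong par (f≗g (el u false))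
    go (yes _) (no _) = cong (λ t → not (does (slot u false ≟? t))) (target-cong f≗g u false)

  encode-supported : ∀ π → SupportedOn Free (encode π)
  encode-supported π u ¬free = trans (lookup∘tabulate (encodeBit (lookup π)) u) (encodeBit-¬Free ¬free)

  module _ {π : Vec (Fin n) n} (π-inv : IsInvolution π) (π-Γ : GraphEq (Γ π) G) where

    private
      f : Fin n → Fin n
      f = lookup π

    open Decoding (encode π)

    f-injective : ∀ {a a′} → f a ≡ f a′ → a ≡ a′
    f-injective {a} {a′} fa≡fa′ = trans (sym (π-inv a)) (trans (cong f fa≡fa′) (π-inv a′))

    B-encodeBit : ∀ u → B u ≡ encodeBit f u
    B-encodeBit = lookup∘tabulate (encodeBit f)

    mult-target≡mult-slot : ∀ u x → mult (target f u) (just x) ≡ mult (slot u) (just x)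
    mult-target≡mult-slot u x = go (u ≟ᶠ x)
      where
      go : Dec (u ≡ x) → mult (target f u) (just x) ≡ mult (slot u) (just x)
      go (yes refl) = trans (cong₂ _+_ (indicator-no (target f u false ≟? just u) (target-≢-self f u false))
                                       (indicator-no (target f u true ≟? just u) (target-≢-self f u true)))
                            (sym (trans (mult-slot u u) (loopless u)))
      go (no u≢x) = trans (sym (Γ≡mult-target π u≢x)) (trans (π-Γ u x) (sym (mult-slot u x)))

    encode-respects : ∀ u → IsSwap (B u) (slot u) (target f u)
    encode-respects u with swap-of-same-mults {slot u} {target f u} (mult-target≡mult-slot u)
    ... | c , swap = go (slot u false ≟? slot u true) (free? u)
      where
      go : Dec (slot u false ≡ slot u true) → Dec (Free u) → IsSwap (B u) (slot u) (target f u)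
      go (yes const) _ = swap-of-constant {slot u} {target f u} (B u) const swap
      go (no ¬const) (yes free) =
        subst (λ c′ → IsSwap c′ (slot u) (target f u))
              (trans (swap-unique {slot u} {target f u} ¬const swap)
                     (sym (trans (B-encodeBit u) (encodeBit-distinct free ¬const))))
              swap
      go (no ¬const) (no ¬free) = subst (λ c′ → IsSwap c′ (slot u) (target f u))
        (sym (trans (B-encodeBit u) (encodeBit-¬Free ¬free)))
        (swap-false {slot u} {target f u} (trans (slot-true-¬Full ¬full) (sym (target-¬Elt ¬full))) swap)
        where
        ¬full : ¬ Full u
        ¬full full with upperEnd? u
        ... | yes upper = ¬const (2-cycle-constant (proj₂ (proj₂ upper)))
        ... | no ¬upper = ¬free (full , ¬upper)

    slot≡away-image : ∀ {u p} → Elt u p → slot u (p xor B u) ≡ away u (block (f (el u p)))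
    slot≡away-image {u} {p} elt = trans (encode-respects u p) (target-Elt elt)

    par-shift : ∀ {u} → Full u → block (f (el u false)) ≡ block (f (el u true)) →
      ∀ p → par (f (el u p)) ≡ p xor par (f (el u false))
    par-shift full same-block false = refl
    par-shift {u} full same-block true = ¬-not λ par≡ →
      case trans (sym (par-el (Elt-false u)))
                 (trans (cong par (f-injective (≡-of-block-par same-block (sym par≡)))) (par-el full))
      of λ ()

    2-cycle-images : ∀ {u d} → G u d ≡ 2 → ∀ p → block (f (el u p)) ≡ d
    2-cycle-images {u} 2-cycle p =
      away-just (trans (sym (slot≡away-image (Elt-of-Full (2-cycle-Full 2-cycle) p))) (2-cycle-slot 2-cycle (p xor B u)))

    2-cycle-par-shift : ∀ {u d} → G u d ≡ 2 → ∀ p → par (f (el u p)) ≡ p xor par (f (el u false))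
    2-cycle-par-shift 2-cycle =
      par-shift (2-cycle-Full 2-cycle) (trans (2-cycle-images 2-cycle false) (sym (2-cycle-images 2-cycle true)))

    2-cycle-par-sym : ∀ {u d} → G u d ≡ 2 → par (f (el d false)) ≡ par (f (el u false))
    2-cycle-par-sym {u} {d} 2-cycle = begin
      x                 ≡⟨ sym (xor-cancelˡ c x) ⟩
      c xor (c xor x)   ≡⟨ cong (c xor_) (sym (2-cycle-par-shift 2-cycle′ c)) ⟩
      c xor par (f (el d c))   ≡⟨ cong (λ a → c xor par (f a)) (el-of-block (2-cycle-images 2-cycle false)) ⟩
      c xor par (f (f (el u false)))  ≡⟨ cong (λ a → c xor par a) (π-inv (el u false)) ⟩
      c xor par (el u false)  ≡⟨ cong (c xor_) (par-el (Elt-false u)) ⟩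
      c xor false             ≡⟨ xor-identityʳ c ⟩
      c                       ∎
      where
      open ≡-Reasoning
      2-cycle′ = trans (symmetric d u) 2-cycle
      c = par (f (el u false))
      x = par (f (el d false))

    2-cycle-bits : ∀ {u d} → G u d ≡ 2 → B u xor B d ≡ par (f (el u false))
    2-cycle-bits {u} {d} 2-cycle with <-cmp u d
    ... | tri< u<d _ _ = begin
      B u xor B d                 ≡⟨ cong₂ _xor_ (B-encodeBit u) (B-encodeBit d) ⟩
      encodeBit f u xor encodeBit f d
        ≡⟨ cong₂ _xor_ (encodeBit-constant (2-cycle-lower-Free 2-cycle u<d) (2-cycle-constant 2-cycle))
                       (encodeBit-¬Free (2-cycle-upper-¬Free 2-cycle′ u<d)) ⟩
      par (f (el u false)) xor false ≡⟨ xor-identityʳ _ ⟩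
      par (f (el u false))        ∎
      where
      open ≡-Reasoning
      2-cycle′ = trans (symmetric d u) 2-cycle
    ... | tri≈ _ refl _ = ⊥-elim (2-cycle-irreflexive 2-cycle refl)
    ... | tri> _ _ d<u = begin
      B u xor B d                 ≡⟨ cong₂ _xor_ (B-encodeBit u) (B-encodeBit d) ⟩
      encodeBit f u xor encodeBit f d
        ≡⟨ cong₂ _xor_ (encodeBit-¬Free (2-cycle-upper-¬Free 2-cycle d<u))
                       (encodeBit-constant (2-cycle-lower-Free 2-cycle′ d<u) (2-cycle-constant 2-cycle′)) ⟩
      par (f (el d false))        ≡⟨ 2-cycle-par-sym 2-cycle ⟩
      par (f (el u false))        ∎
      where
      open ≡-Reasoning
      2-cycle′ = trans (symmetric d u) 2-cycle

    parity-2-cycle : ∀ {u d} → G u d ≡ 2 → ∀ p → (p xor B u) xor B d ≡ par (f (el u p))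
    parity-2-cycle {u} {d} 2-cycle p = begin
      (p xor B u) xor B d          ≡⟨ xor-assoc p (B u) (B d) ⟩
      p xor (B u xor B d)          ≡⟨ cong (p xor_) (2-cycle-bits 2-cycle) ⟩
      p xor par (f (el u false))   ≡⟨ sym (2-cycle-par-shift 2-cycle p) ⟩
      par (f (el u p))             ∎
      where open ≡-Reasoning

    parity-isolated : ∀ {u p} → slot u false ≡ nothing → Elt u p → p xor B u ≡ par (f (el u p))
    parity-isolated {u} {p} s₀ elt = go (Elt? u true)
      where
      stays : ∀ {q} → Elt u q → block (f (el u q)) ≡ u
      stays elt′ = away-nothing (trans (sym (slot≡away-image elt′)) (slot-isolated s₀ _))
      go : Dec (Full u) → p xor B u ≡ par (f (el u p))
      go (yes full) = begin
        p xor B u                   ≡⟨ cong (p xor_) (trans (B-encodeBit u) (encodeBit-constant free const)) ⟩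
        p xor par (f (el u false))  ≡⟨ sym (par-shift full (trans (stays (Elt-false u)) (sym (stays full))) p) ⟩
        par (f (el u p))            ∎
        where
        open ≡-Reasoning
        free : Free u
        free = full , λ (_ , _ , 2-cycle) → case trans (sym s₀) (2-cycle-slot 2-cycle false) of λ ()
        const : slot u false ≡ slot u true
        const = trans s₀ (sym (slot-isolated s₀ true))
      go (no ¬full) rewrite Elt-¬Full elt ¬full | trans (B-encodeBit u) (encodeBit-¬Free (¬full ∘ proj₁)) =
        sym (Elt-¬Full (Elt-of-block (stays (Elt-false u))) ¬full)

    fixed-if-stays : ∀ {u p x} → slot u false ≡ just x → Elt u p → block (f (el u p)) ≡ u → f (el u p) ≡ el u p
    fixed-if-stays {u} {p} s₀ elt stays = go (q Data.Bool.≟ p)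
      where
      q = par (f (el u p))
      el-q : el u q ≡ f (el u p)
      el-q = el-of-block stays
      go : Dec (q ≡ p) → f (el u p) ≡ el u p
      go (yes q≡p) = trans (sym el-q) (cong (el u) q≡p)
      go (no q≢p) = case trans (sym s₀) (slot-false-of-both {u} {p xor B u} sₚ s-q) of λ ()
        where
        stays-q : block (f (el u q)) ≡ u
        stays-q = trans (cong (block ∘ f) el-q) (trans (cong block (π-inv (el u p))) (block-el elt))
        empty : ∀ {r} → Elt u r → block (f (el u r)) ≡ u → slot u (r xor B u) ≡ nothing
        empty elt′ stays′ = trans (slot≡away-image elt′) (trans (cong (away u) stays′) (away-self u))
        sₚ : slot u (p xor B u) ≡ nothing
        sₚ = empty elt stays
        s-q : slot u (not (p xor B u)) ≡ nothing
        s-q = subst (λ r → slot u r ≡ nothing)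
                    (trans (cong (_xor B u) (¬-not q≢p)) (sym (not-distribˡ-xor p (B u))))
                    (empty (Elt-of-block stays) stays-q)

    decodeAt-encode : ∀ {u p} → Elt u p → uncurry el (decodeAt u p) ≡ f (el u p)
    decodeAt-encode {u} {p} elt = go (d ≟ᶠ u)
      where
      open ≡-Reasoning
      d = block (f (el u p))
      q = par (f (el u p))
      go : Dec (d ≡ u) → uncurry el (decodeAt u p) ≡ f (el u p)
      go (no d≢u) = begin
        uncurry el (decodeAt u p)                    ≡⟨ cong (uncurry el) (decodeAt-just sᵢ) ⟩
        el d (partnerSlot u (p xor B u) d xor B d)   ≡⟨ cong (el d) partner-bit ⟩
        el d q                                       ≡⟨ el-block-par (f (el u p)) ⟩
        f (el u p)                                   ∎
        where
        sᵢ : slot u (p xor B u) ≡ just d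
        sᵢ = trans (slot≡away-image elt) (away-other d≢u)
        back : slot d (q xor B d) ≡ just u
        back = trans (slot≡away-image (Elt-block-par (f (el u p))))
                     (trans (cong (away d ∘ block) (trans (cong f (el-block-par (f (el u p)))) (π-inv (el u p))))
                            (trans (cong (away d) (block-el elt)) (away-other (d≢u ∘ sym))))
        -- the image sits in a slot of d holding u: the matched one, unless u and d form a 2-cycle
        partner-bit : partnerSlot u (p xor B u) d xor B d ≡ q
        partner-bit with partnerSlot-unique sᵢ back
        ... | inj₁ partner≡ = trans (cong (_xor B d) partner≡) (xor-cancelʳ q (B d))
        ... | inj₂ 2-cycle = trans (cong (_xor B d) (partnerSlot-back (2-cycle-slot 2-cycle (p xor B u))))
                                   (parity-2-cycle (trans (symmetric u d) 2-cycle) p)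
      go (yes d≡u) = stay (slot u false) refl
        where
        sᵢ : slot u (p xor B u) ≡ nothing
        sᵢ = trans (slot≡away-image elt) (trans (cong (away u) d≡u) (away-self u))
        stay : ∀ m → slot u false ≡ m → uncurry el (decodeAt u p) ≡ f (el u p)
        stay nothing s₀ = begin
          uncurry el (decodeAt u p)   ≡⟨ cong (uncurry el) (decodeAt-isolated s₀) ⟩
          el u (p xor B u)            ≡⟨ cong (el u) (parity-isolated s₀ elt) ⟩
          el u q                      ≡⟨ el-of-block d≡u ⟩
          f (el u p)                  ∎
        stay (just _) s₀ = trans (cong (uncurry el) (decodeAt-stay sᵢ s₀)) (sym (fixed-if-stays s₀ elt d≡u))

    decode-encode : tabulate decode ≡ π
    decode-encode = trans (tabulate-cong decode≗f) (tabulate∘lookup π)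
      where
      decode≗f : ∀ a → decode a ≡ f a
      decode≗f a = trans (decodeAt-encode (Elt-block-par a)) (cong f (el-block-par a))

  module _ {b : Vec Bool ⌈ n /2⌉} (b-supp : SupportedOn Free b) where

    open Decoding b

    encodeBit-decode : ∀ u → encodeBit decode u ≡ B u
    encodeBit-decode u = go (free? u) (slot u false ≟? slot u true)
      where
      go : Dec (Free u) → Dec (slot u false ≡ slot u true) → encodeBit decode u ≡ B u
      go (no ¬free) _ = trans (encodeBit-¬Free ¬free) (sym (b-supp u ¬free))
      go (yes free) (no ¬const) =
        trans (encodeBit-distinct free ¬const)
              (sym (swap-unique {slot u} {target decode u} ¬const (decode-respects b-supp u)))
      go (yes free@(full , _)) (yes const) = trans (encodeBit-constant free const) (par-first (slot u false) refl)
        where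
        par-first : ∀ m → slot u false ≡ m → par (decode (el u false)) ≡ B u
        par-first nothing s₀ = begin
          par (decode (el u false))          ≡⟨ cong par (decode-el (Elt-false u)) ⟩
          par (uncurry el (decodeAt u false)) ≡⟨ cong (par ∘ uncurry el) (decodeAt-isolated s₀) ⟩
          par (el u (B u))                    ≡⟨ par-el (Elt-of-Full full (B u)) ⟩
          B u                                 ∎
          where open ≡-Reasoning
        par-first (just x) s₀ = begin
          par (decode (el u false))             ≡⟨ cong par (decode-el (Elt-false u)) ⟩
          par (uncurry el (decodeAt u false))
            ≡⟨ cong (par ∘ uncurry el) (decodeAt-just (2-cycle-slot 2-cycle (B u))) ⟩
          par (el x (partnerSlot u (B u) x xor B x))  ≡⟨ par-el (Elt-of-Full (2-cycle-Full 2-cycle′) _) ⟩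
          partnerSlot u (B u) x xor B x
            ≡⟨ cong₂ _xor_ (partnerSlot-back (2-cycle-slot 2-cycle′ (B u))) (b-supp x (2-cycle-Free-end 2-cycle free)) ⟩
          B u xor false                         ≡⟨ xor-identityʳ (B u) ⟩
          B u                                   ∎
          where
          open ≡-Reasoning
          2-cycle : G u x ≡ 2
          2-cycle = 2-cycle-of-slots {i = false} s₀ (trans (sym const) s₀)
          2-cycle′ : G x u ≡ 2
          2-cycle′ = trans (symmetric x u) 2-cycle

    encode-decode : encode (tabulate decode) ≡ b
    encode-decode = trans (tabulate-cong λ u → trans (encodeBit-cong (lookup∘tabulate decode) u) (encodeBit-decode u))
                          (tabulate∘lookup b)

  -- Counting

  full-count : length (filter (λ u → Elt? u true) (allFin ⌈ n /2⌉)) ≡ ⌊ n /2⌋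
  full-count = sym (trans (sym (length-tabulate id))
    (length-≡-via-bijection inject (Unique.allFin⁺ _) (Unique.filter⁺ (λ u → Elt? u true) (Unique.allFin⁺ _))
      (λ _ _ eq → toℕ-injective (trans (sym (toℕ-inject≤ _ _)) (trans (cong toℕ eq) (toℕ-inject≤ _ _))))
      (λ {i} _ → ∈-filter⁺ (λ u → Elt? u true) (∈-allFin _)
                   (pos-true-<⇐ _ n (subst (_< ⌊ n /2⌋) (sym (toℕ-inject≤ i _)) (toℕ<n i))))
      onto))
    where
    inject : Fin ⌊ n /2⌋ → Vtx n
    inject i = inject≤ i (⌊n/2⌋≤⌈n/2⌉ n)
    onto : ∀ {u} → u ∈ filter (λ u → Elt? u true) (allFin _) → ∃ λ i → i ∈ allFin _ × inject i ≡ u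
    onto {u} u∈ with ∈-filter⁻ (λ u → Elt? u true) {xs = allFin _} u∈
    ... | _ , full = i , ∈-allFin i , toℕ-injective (trans (toℕ-inject≤ i _) (toℕ-fromℕ< _))
      where i = fromℕ< (pos-true-<⇒ (toℕ u) n full)

  upperEnd-count : twoCycles G ≡ length (filter upperEnd? (allFin ⌈ n /2⌉))
  upperEnd-count = length-≡-via-bijection proj₂
    (Unique.filter⁺ 2-cycle? (Unique.cartesianProduct⁺ (Unique.allFin⁺ _) (Unique.allFin⁺ _)))
    (Unique.filter⁺ upperEnd? (Unique.allFin⁺ _))
    injective into onto
    where
    2-cycle? : ∀ (e : Vtx n × Vtx n) → Dec (toℕ (proj₁ e) < toℕ (proj₂ e) × G (proj₁ e) (proj₂ e) ≡ 2)
    2-cycle? e = (toℕ (proj₁ e) <? toℕ (proj₂ e)) ×-dec (G (proj₁ e) (proj₂ e) ≟ⁿ 2)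
    pairs = cartesianProduct (allFin ⌈ n /2⌉) (allFin ⌈ n /2⌉)
    injective : ∀ {e e′} → e ∈ filter 2-cycle? pairs → e′ ∈ filter 2-cycle? pairs →
      proj₂ e ≡ proj₂ e′ → e ≡ e′
    injective {x , w} {x′ , .w} e∈ e′∈ refl
      with ∈-filter⁻ 2-cycle? {xs = pairs} e∈ | ∈-filter⁻ 2-cycle? {xs = pairs} e′∈
    ... | _ , _ , xw | _ , _ , x′w = cong (_, w) (2-cycle-unique (trans (symmetric w x) xw) (trans (symmetric w x′) x′w))
    into : ∀ {e} → e ∈ filter 2-cycle? pairs → proj₂ e ∈ filter upperEnd? (allFin _)
    into {x , w} e∈ with ∈-filter⁻ 2-cycle? {xs = pairs} e∈
    ... | _ , x<w , xw = ∈-filter⁺ upperEnd? (∈-allFin w) (x , x<w , trans (symmetric w x) xw)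
    onto : ∀ {w} → w ∈ filter upperEnd? (allFin _) → ∃ λ e → e ∈ filter 2-cycle? pairs × proj₂ e ≡ w
    onto {w} w∈ with ∈-filter⁻ upperEnd? {xs = allFin _} w∈
    ... | _ , x , x<w , wx =
      (x , w) , ∈-filter⁺ 2-cycle? (∈-cartesianProduct⁺ (∈-allFin x) (∈-allFin w)) (x<w , trans (symmetric x w) wx) , refl

  free-count : length (filter free? (allFin ⌈ n /2⌉)) ≡ ⌊ n /2⌋ ∸ twoCycles G
  free-count = begin
    length (filter free? all)                                    ≡⟨ sym (m+n∸m≡n (twoCycles G) _) ⟩
    twoCycles G + length (filter free? all) ∸ twoCycles G
      ≡⟨ cong (λ k → k + length (filter free? all) ∸ twoCycles G) (trans upperEnd-count upper-in-full) ⟩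
    length (filter upperEnd? full) + length (filter free? all) ∸ twoCycles G
      ≡⟨ cong (λ k → length (filter upperEnd? full) + k ∸ twoCycles G) free-in-full ⟩
    length (filter upperEnd? full) + length (filter (¬? ∘ upperEnd?) full) ∸ twoCycles G
      ≡⟨ cong (_∸ twoCycles G) (trans (length-filter+length-filter-∁ upperEnd? full) full-count) ⟩
    ⌊ n /2⌋ ∸ twoCycles G                                        ∎
    where
    open ≡-Reasoning
    all = allFin ⌈ n /2⌉
    full = filter (λ u → Elt? u true) all
    full! : Unique full
    full! = Unique.filter⁺ _ (Unique.allFin⁺ _)
    upper-in-full : length (filter upperEnd? all) ≡ length (filter upperEnd? full)
    upper-in-full =
      length-≡-of-same-elements (Unique.filter⁺ upperEnd? (Unique.allFin⁺ _)) (Unique.filter⁺ upperEnd? full!)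
      (λ {u} u∈ → let _ , upper = ∈-filter⁻ upperEnd? {xs = all} u∈ in
         ∈-filter⁺ upperEnd? (∈-filter⁺ (λ u → Elt? u true) (∈-allFin u) (2-cycle-Full (proj₂ (proj₂ upper)))) upper)
      (λ {u} u∈ → ∈-filter⁺ upperEnd? (∈-allFin u) (proj₂ (∈-filter⁻ upperEnd? {xs = full} u∈)))
    free-in-full : length (filter free? all) ≡ length (filter (¬? ∘ upperEnd?) full)
    free-in-full =
      length-≡-of-same-elements (Unique.filter⁺ free? (Unique.allFin⁺ _)) (Unique.filter⁺ (¬? ∘ upperEnd?) full!)
      (λ {u} u∈ → let _ , full , ¬upper = ∈-filter⁻ free? {xs = all} u∈ in
         ∈-filter⁺ (¬? ∘ upperEnd?) (∈-filter⁺ (λ u → Elt? u true) (∈-allFin u) full) ¬upper)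
      (λ {u} u∈ → let u∈full , ¬upper = ∈-filter⁻ (¬? ∘ upperEnd?) {xs = full} u∈ in
         ∈-filter⁺ free? (∈-allFin u) (proj₂ (∈-filter⁻ (λ u → Elt? u true) {xs = all} u∈full) , ¬upper))

  countInvolutions≡length-subvectors : countInvolutions n G ≡ length (subvectors free?)
  countInvolutions≡length-subvectors = length-≡-via-bijection encode
    (Unique.filter⁺ valid? (allVecs-unique n (Unique.allFin⁺ n))) (subvectors-unique free?) injective into onto
    where
    valid? = λ π → isInvolution? π ×-dec graphEq? (Γ π) G
    injective : ∀ {π π′} → π ∈ filter valid? (allMaps n) → π′ ∈ filter valid? (allMaps n) →
      encode π ≡ encode π′ → π ≡ π′
    injective π∈ π′∈ eq
      with ∈-filter⁻ valid? {xs = allMaps n} π∈ | ∈-filter⁻ valid? {xs = allMaps n} π′∈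
    ... | _ , π-inv , π-Γ | _ , π′-inv , π′-Γ =
      trans (sym (decode-encode π-inv π-Γ))
            (trans (cong (tabulate ∘ Decoding.decode) eq) (decode-encode π′-inv π′-Γ))
    into : ∀ {π} → π ∈ filter valid? (allMaps n) → encode π ∈ subvectors free?
    into {π} _ = ∈-subvectors⁺ free? (encode-supported π)
    onto : ∀ {b} → b ∈ subvectors free? → ∃ λ π → π ∈ filter valid? (allMaps n) × encode π ≡ b
    onto {b} b∈ = tabulate decode
                , ∈-filter⁺ valid? (∈-allVecs _ (λ _ → ∈-allFin _)) (decode-involutive b-supp , decode-Γ b-supp)
                , encode-decode b-supp
      where
      open Decoding b
      b-supp = ∈-subvectors⁻ free? b∈


corollary3p1 : (n : ℕ) (G : MGraph n) → InG n G → (s : ℕ) → twoCycles G ≡ s →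
    countInvolutions n G ≡ 2 ^ (⌊ n /2⌋ ∸ s)
corollary3p1 n G G∈𝔊 s refl = begin
  countInvolutions n G                              ≡⟨ countInvolutions≡length-subvectors G G∈𝔊 ⟩
  length (subvectors (free? G G∈𝔊))                 ≡⟨ length-subvectors (free? G G∈𝔊) ⟩
  2 ^ length (filter (free? G G∈𝔊) (allFin ⌈ n /2⌉)) ≡⟨ cong (2 ^_) (free-count G G∈𝔊) ⟩
  2 ^ (⌊ n /2⌋ ∸ twoCycles G)                       ∎
  where open ≡-Reasoning
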